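{- Let $G = Z_{18}\times Z_{13}$ with multiplication $[x,y][u,v] = [x+u \bmod 18,\; y\cdot 3^{u} + v \bmod 13]$ (a group of order $234$). Let $S=\{g,g^{ -1} : g\in\{[7,5],[5,1],[16,12],[14,2]\}\}$. Then $S$ consists of exactly $8$ non-identity elements and the Cayley graph $\mathrm{Cay}(G,S)$ is a connected $8$-regular graph of diameter $3$ on $234$ vertices.
   Context: For a finite group $G$ and an inverse-closed subset $S\subseteq G$ not containing the identity, the Cayley graph $\mathrm{Cay}(G,S)$ is the undirected graph with vertex set $G$ in which $x$ and $y$ are adjacent iff $y=xs$ for some $s\in S$; it is $|S|$-regular. The diameter of a connected graph is the maximum over all pairs of vertices of the length of a shortest path between them. For integers $m,n$ and a unit $a$ of $Z_n$ whose multiplicative order divides $m$, the group $m\times_a n$ is the set $Z_m\times Z_n$ with multiplication $[x,y][u,v]=[x+u \bmod m,\; y a^u+v \bmod n]$. -}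

module Defs where

open import Data.Nat using (ℕ; zero; suc; _+_; _*_; _∸_; _^_; _≤_)
open import Data.Nat.DivMod using (_mod_; _%_)
open import Data.Fin using (Fin; toℕ) renaming (zero to fzero)
open import Data.Product using (_×_; _,_; ∃; ∃-syntax; Σ)
open import Data.List using (List; []; _∷_; _++_; map; length)
open import Data.List.Membership.Propositional using (_∈_)
open import Data.List.Relation.Unary.Unique.Propositional using (Unique)
open import Relation.Binary.PropositionalEquality using (_≡_)
open import Relation.Nullary using (¬_)
open import Function.Bundles using (_⇔_)

G : Set
G = Fin 18 × Fin 13

_·_ : G → G → G
(x , y) · (u , v) = ((toℕ x + toℕ u) mod 18 , (toℕ y * 3 ^ toℕ u + toℕ v) mod 13)

e : G
e = (fzero , fzero)

inv : G → G
inv (x , y) = (x' mod 18 , (13 ∸ ((toℕ y * 3 ^ (x' % 18)) % 13)) mod 13)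
  where x' = 18 ∸ toℕ x

mk : ℕ → ℕ → G
mk a b = (a mod 18 , b mod 13)

gens : List G
gens = mk 7 5 ∷ mk 5 1 ∷ mk 16 12 ∷ mk 14 2 ∷ []

S : List G
S = gens ++ map inv gens

Adj : G → G → Set
Adj x y = ∃[ s ] (s ∈ S × y ≡ x · s)

data Walk : ℕ → G → G → Set where
  here : ∀ {x} → Walk 0 x x
  step : ∀ {n x y z} → Adj x y → Walk n y z → Walk (suc n) x z

DistLe : ℕ → G → G → Set
DistLe n x y = ∃[ m ] (m ≤ n × Walk m x y)

Connected : Set
Connected = ∀ x y → ∃[ n ] Walk n x y

HasVertexCount : ℕ → Set
HasVertexCount k = Σ (List G) λ V → Unique V × length V ≡ k × (∀ g → g ∈ V)

Regular : ℕ → Set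
Regular k = ∀ x → Σ (List G) λ N → Unique N × length N ≡ k × (∀ y → (y ∈ N ⇔ Adj x y))

HasDiameter : ℕ → Set
HasDiameter d = (∀ x y → DistLe d x y) × ∃[ x ] ∃[ y ] (¬ DistLe (d ∸ 1) x y)

module Submission where

-- The multiplication is the semidirect product in which u ∈ Z₁₈ acts on Z₁₃ by
-- multiplication with 3^u; it is associative because 3¹⁸ ≡ 1 (mod 13). Left
-- multiplication by x maps walks to walks, so d(x, y) = d(e, x⁻¹y) and it suffices
-- to enumerate the walks from e: those of length ≤ 3 reach all 234 elements, those
-- of length ≤ 2 miss [3,0]. The neighbours x s (s ∈ S) of x are distinct by left
-- cancellation.

open import Defs
open import Data.Product using (_×_)
open import Data.List using (length)
open import Data.List.Membership.Propositional using (_∉_)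
open import Data.List.Relation.Unary.Unique.Propositional using (Unique)
open import Relation.Binary.PropositionalEquality using (_≡_)

open import Data.Nat using (ℕ; zero; suc; _+_; _*_; _^_; _≤_; z≤n; s≤s; NonZero)
open import Data.Nat.Properties using (+-assoc; ^-distribˡ-+-*; ^-*-assoc; *-comm; *-identityʳ)
open import Data.Nat.DivMod using (_mod_; _%_; _/_; m%n%n≡m%n; m%n<n; %-distribˡ-+; %-distribˡ-*; m≡m%n+[m/n]*n)
open import Data.Nat.Tactic.RingSolver using (solve-∀)
open import Data.Fin using (Fin; toℕ) renaming (_≟_ to _≟ᶠ_)
open import Data.Fin.Properties using (toℕ-fromℕ<; toℕ-injective)
open import Data.Product using (_,_; proj₂; map₂)
open import Data.Product.Properties using (≡-dec)
open import Data.List using (List; []; _∷_; map; concatMap; cartesianProduct; allFin)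
open import Data.List.Membership.Propositional using (_∈_; find)
open import Data.List.Membership.Propositional.Properties
  using (∈-map⁺; ∈-map⁻; ∈-concatMap⁺; ∈-concatMap⁻; ∈-cartesianProduct⁺; ∈-allFin)
open import Data.List.Relation.Unary.Any using (here; there)
import Data.List.Relation.Unary.Any as Any
import Data.List.Relation.Unary.All as All
open import Data.List.Relation.Unary.Unique.Propositional.Properties using (map⁺; cartesianProduct⁺; allFin⁺)
import Data.List.Relation.Unary.Unique.DecPropositional as UniqueDec
import Data.List.Membership.DecPropositional as MembershipDec
open import Relation.Binary using (Setoid; DecidableEquality)
open import Relation.Binary.PropositionalEquality using (refl; sym; trans; cong; cong₂; subst₂; isEquivalence; module ≡-Reasoning)
import Relation.Binary.Construct.On as On
import Relation.Binary.Reasoning.Setoid as SetoidReasoning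
open import Relation.Nullary using (Dec)
open import Relation.Nullary.Decidable using (map′; from-yes; from-no)
open import Function using (_∘_)
open import Function.Bundles using (mk⇔)
open import Level using (0ℓ)

module Congruence (n : ℕ) .{{_ : NonZero n}} where

  infix 4 _≈_
  _≈_ : ℕ → ℕ → Set
  a ≈ b = a % n ≡ b % n

  setoid : Setoid 0ℓ 0ℓ
  setoid = record { isEquivalence = On.isEquivalence (_% n) isEquivalence }

  toℕ-mod-≈ : ∀ a → toℕ (a mod n) ≈ a
  toℕ-mod-≈ a = trans (cong (_% n) (toℕ-fromℕ< (m%n<n a n))) (m%n%n≡m%n a n)

  mod-cong : ∀ {a b} → a ≈ b → a mod n ≡ b mod n
  mod-cong {a} {b} a≈b = toℕ-injective (begin
    toℕ (a mod n) ≡⟨ toℕ-fromℕ< (m%n<n a n) ⟩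
    a % n         ≡⟨ a≈b ⟩
    b % n         ≡⟨ toℕ-fromℕ< (m%n<n b n) ⟨
    toℕ (b mod n) ∎)
    where open ≡-Reasoning

  +-cong : ∀ {a b c d} → a ≈ b → c ≈ d → a + c ≈ b + d
  +-cong {a} {b} {c} {d} a≈b c≈d = begin
    (a + c) % n           ≡⟨ %-distribˡ-+ a c n ⟩
    (a % n + c % n) % n   ≡⟨ cong₂ (λ x y → (x + y) % n) a≈b c≈d ⟩
    (b % n + d % n) % n   ≡⟨ %-distribˡ-+ b d n ⟨
    (b + d) % n           ∎
    where open ≡-Reasoning

  *-cong : ∀ {a b c d} → a ≈ b → c ≈ d → a * c ≈ b * d
  *-cong {a} {b} {c} {d} a≈b c≈d = begin
    (a * c) % n           ≡⟨ %-distribˡ-* a c n ⟩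
    (a % n * (c % n)) % n ≡⟨ cong₂ (λ x y → (x * y) % n) a≈b c≈d ⟩
    (b % n * (d % n)) % n ≡⟨ %-distribˡ-* b d n ⟨
    (b * d) % n           ∎
    where open ≡-Reasoning

  ^-≈1 : ∀ {a} k → a ≈ 1 → a ^ k ≈ 1
  ^-≈1 zero    a≈1 = refl
  ^-≈1 (suc k) a≈1 = *-cong a≈1 (^-≈1 k a≈1)

  ^-%-period : ∀ {a} m .{{_ : NonZero m}} → a ^ m ≈ 1 → ∀ k → a ^ (k % m) ≈ a ^ k
  ^-%-period {a} m aᵐ≈1 k = begin
    a ^ (k % m)                     ≡⟨ *-identityʳ (a ^ (k % m)) ⟨
    a ^ (k % m) * 1                 ≈⟨ *-cong {a ^ (k % m)} refl (^-≈1 (k / m) aᵐ≈1) ⟨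
    a ^ (k % m) * (a ^ m) ^ (k / m) ≡⟨ cong (a ^ (k % m) *_) (^-*-assoc a m (k / m)) ⟩
    a ^ (k % m) * a ^ (m * (k / m)) ≡⟨ ^-distribˡ-+-* a (k % m) (m * (k / m)) ⟨
    a ^ (k % m + m * (k / m))       ≡⟨ cong (λ j → a ^ (k % m + j)) (*-comm m (k / m)) ⟩
    a ^ (k % m + k / m * m)         ≡⟨ cong (a ^_) (m≡m%n+[m/n]*n k m) ⟨
    a ^ k                           ∎
    where open SetoidReasoning setoid

module SemidirectProduct (m n a : ℕ) .{{_ : NonZero m}} .{{_ : NonZero n}}
                         (aᵐ≈1 : a ^ m % n ≡ 1 % n) where

  private
    module M = Congruence m
    module N = Congruence n

  _∙_ : Fin m × Fin n → Fin m × Fin n → Fin m × Fin n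
  (x , y) ∙ (u , v) = ((toℕ x + toℕ u) mod m , (toℕ y * a ^ toℕ u + toℕ v) mod n)

  ∙-assoc : ∀ g h k → (g ∙ h) ∙ k ≡ g ∙ (h ∙ k)
  ∙-assoc (x , y) (u , v) (u′ , v′) = cong₂ _,_ (M.mod-cong first) (N.mod-cong second)
    where
    first : toℕ ((toℕ x + toℕ u) mod m) + toℕ u′ M.≈ toℕ x + toℕ ((toℕ u + toℕ u′) mod m)
    first = begin
      toℕ ((toℕ x + toℕ u) mod m) + toℕ u′ ≈⟨ M.+-cong (M.toℕ-mod-≈ (toℕ x + toℕ u)) refl ⟩
      toℕ x + toℕ u + toℕ u′               ≡⟨ +-assoc (toℕ x) (toℕ u) (toℕ u′) ⟩
      toℕ x + (toℕ u + toℕ u′)             ≈⟨ M.+-cong {toℕ x} refl (M.toℕ-mod-≈ (toℕ u + toℕ u′)) ⟨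
      toℕ x + toℕ ((toℕ u + toℕ u′) mod m) ∎
      where open SetoidReasoning M.setoid
    A B : ℕ
    A = a ^ toℕ u
    B = a ^ toℕ u′
    power-+ : a ^ toℕ ((toℕ u + toℕ u′) mod m) N.≈ A * B
    power-+ = begin
      a ^ toℕ ((toℕ u + toℕ u′) mod m) ≡⟨ cong (a ^_) (toℕ-fromℕ< (m%n<n (toℕ u + toℕ u′) m)) ⟩
      a ^ ((toℕ u + toℕ u′) % m)       ≈⟨ N.^-%-period m aᵐ≈1 (toℕ u + toℕ u′) ⟩
      a ^ (toℕ u + toℕ u′)             ≡⟨ ^-distribˡ-+-* a (toℕ u) (toℕ u′) ⟩
      A * B                            ∎
      where open SetoidReasoning N.setoid
    second : toℕ ((toℕ y * A + toℕ v) mod n) * B + toℕ v′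
         N.≈ toℕ y * a ^ toℕ ((toℕ u + toℕ u′) mod m) + toℕ ((toℕ v * B + toℕ v′) mod n)
    second = begin
      toℕ ((toℕ y * A + toℕ v) mod n) * B + toℕ v′ ≈⟨ N.+-cong (N.*-cong (N.toℕ-mod-≈ (toℕ y * A + toℕ v)) refl) refl ⟩
      (toℕ y * A + toℕ v) * B + toℕ v′             ≡⟨ expand (toℕ y) (toℕ v) A B (toℕ v′) ⟩
      toℕ y * (A * B) + (toℕ v * B + toℕ v′)       ≈⟨ N.+-cong (N.*-cong {toℕ y} refl power-+) (N.toℕ-mod-≈ (toℕ v * B + toℕ v′)) ⟨
      toℕ y * a ^ toℕ ((toℕ u + toℕ u′) mod m) + toℕ ((toℕ v * B + toℕ v′) mod n) ∎
      where
      open SetoidReasoning N.setoid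
      expand : ∀ y v A B v′ → (y * A + v) * B + v′ ≡ y * (A * B) + (v * B + v′)
      expand = solve-∀

-- Unlike the group laws decided below, associativity would need all 234³
-- triples to be enumerated.
·-assoc : ∀ g h k → (g · h) · k ≡ g · (h · k)
·-assoc = SemidirectProduct.∙-assoc 18 13 3 refl

infix 4 _≟_
_≟_ : DecidableEquality G
_≟_ = ≡-dec _≟ᶠ_ _≟ᶠ_

elements : List G
elements = cartesianProduct (allFin 18) (allFin 13)

∈-elements : ∀ g → g ∈ elements
∈-elements (x , y) = ∈-cartesianProduct⁺ (∈-allFin x) (∈-allFin y)

∀-dec : {P : G → Set} → (∀ g → Dec (P g)) → Dec (∀ g → P g)
∀-dec P? = map′ (λ all g → All.lookup all (∈-elements g)) (λ all → All.tabulate (λ {g} _ → all g))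
                (All.all? P? elements)

·-identityˡ : ∀ g → e · g ≡ g
·-identityˡ = from-yes (∀-dec λ g → e · g ≟ g)

·-identityʳ : ∀ g → g · e ≡ g
·-identityʳ = from-yes (∀-dec λ g → g · e ≟ g)

·-inverseˡ : ∀ g → inv g · g ≡ e
·-inverseˡ = from-yes (∀-dec λ g → inv g · g ≟ e)

·-inverseʳ : ∀ g → g · inv g ≡ e
·-inverseʳ = from-yes (∀-dec λ g → g · inv g ≟ e)

·-cancelˡ : ∀ g {h k} → g · h ≡ g · k → h ≡ k
·-cancelˡ g {h} {k} gh≡gk = begin
  h               ≡⟨ ·-identityˡ h ⟨
  e · h           ≡⟨ cong (_· h) (·-inverseˡ g) ⟨
  (inv g · g) · h ≡⟨ ·-assoc (inv g) g h ⟩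
  inv g · (g · h) ≡⟨ cong (inv g ·_) gh≡gk ⟩
  inv g · (g · k) ≡⟨ ·-assoc (inv g) g k ⟨
  (inv g · g) · k ≡⟨ cong (_· k) (·-inverseˡ g) ⟩
  e · k           ≡⟨ ·-identityˡ k ⟩
  k               ∎
  where open ≡-Reasoning

x·[inv-x·y]≡y : ∀ g h → g · (inv g · h) ≡ h
x·[inv-x·y]≡y g h = begin
  g · (inv g · h) ≡⟨ ·-assoc g (inv g) h ⟨
  (g · inv g) · h ≡⟨ cong (_· h) (·-inverseʳ g) ⟩
  e · h           ≡⟨ ·-identityˡ h ⟩
  h               ∎
  where open ≡-Reasoning

walk-translate : ∀ g {n x y} → Walk n x y → Walk n (g · x) (g · y)
walk-translate g here = here
walk-translate g {x = x} (step (s , s∈S , refl) w) =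
  step (s , s∈S , sym (·-assoc g x s)) (walk-translate g w)

DistLe-from-e : ∀ {n} → (∀ g → DistLe n e g) → ∀ x y → DistLe n x y
DistLe-from-e dist x y with dist (inv x · y)
... | m , m≤n , w = m , m≤n , subst₂ (Walk m) (·-identityʳ x) (x·[inv-x·y]≡y x y) (walk-translate x w)

ball : ℕ → G → List G
ball zero    x = x ∷ []
ball (suc n) x = x ∷ concatMap (λ s → ball n (x · s)) S

∈-ball⇒DistLe : ∀ n {x y} → y ∈ ball n x → DistLe n x y
∈-ball⇒DistLe zero    (here refl) = 0 , z≤n , here
∈-ball⇒DistLe (suc n) (here refl) = 0 , z≤n , here
∈-ball⇒DistLe (suc n) {x} (there y∈) with find (∈-concatMap⁻ (λ s → ball n (x · s)) y∈)
... | s , s∈S , y∈ball with ∈-ball⇒DistLe n y∈ball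
...   | m , m≤n , w = suc m , s≤s m≤n , step (s , s∈S , refl) w

walk⇒∈-ball : ∀ {m n x y} → m ≤ n → Walk m x y → y ∈ ball n x
walk⇒∈-ball {n = zero}  z≤n here = here refl
walk⇒∈-ball {n = suc n} z≤n here = here refl
walk⇒∈-ball {n = suc n} {x} (s≤s m≤n) (step (s , s∈S , refl) w) =
  there (∈-concatMap⁺ (λ s → ball n (x · s)) (Any.map (λ { refl → walk⇒∈-ball m≤n w }) s∈S))

DistLe⇒∈-ball : ∀ {n x y} → DistLe n x y → y ∈ ball n x
DistLe⇒∈-ball (m , m≤n , w) = walk⇒∈-ball m≤n w

diameter⇒connected : ∀ {d} → HasDiameter d → Connected
diameter⇒connected (within-d , _) x y = map₂ proj₂ (within-d x y)

open MembershipDec _≟_ using (_∈?_)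

S-unique : Unique S
S-unique = from-yes (UniqueDec.unique? _≟_ S)

e∉S : e ∉ S
e∉S = from-no (e ∈? S)

ball-3-e-covers : ∀ g → g ∈ ball 3 e
ball-3-e-covers = from-yes (∀-dec (_∈? ball 3 e))

far : G
far = mk 3 0

far∉ball-2-e : far ∉ ball 2 e
far∉ball-2-e = from-no (far ∈? ball 2 e)

diameter-3 : HasDiameter 3
diameter-3 = DistLe-from-e (∈-ball⇒DistLe 3 ∘ ball-3-e-covers)
           , e , far , far∉ball-2-e ∘ DistLe⇒∈-ball

regular : Regular 8
regular x = map (x ·_) S , map⁺ (·-cancelˡ x) S-unique , refl ,
  λ y → mk⇔ (∈-map⁻ (x ·_)) λ { (s , s∈S , refl) → ∈-map⁺ (x ·_) s∈S }

vertex-count : HasVertexCount 234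
vertex-count = elements , cartesianProduct⁺ (allFin⁺ 18) (allFin⁺ 13) , refl , ∈-elements

mainTheorem7 : (Unique S × length S ≡ 8 × e ∉ S)
    × (Connected × Regular 8 × HasDiameter 3 × HasVertexCount 234)
mainTheorem7 = (S-unique , refl , e∉S)
             , (diameter⇒connected diameter-3 , regular , diameter-3 , vertex-count)
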